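{- Let $\mathcal N$ be a phylogenetic network on $X$, let $A\subseteq X$, let $G_A$ be the path graph of $\mathcal N$ on $A$, and let $G_A=G_0,G_1,\dots,G_k=\mathcal N_A$ be a sequence of directed graphs such that, for each $i\in\{1,\dots,k\}$, $G_i$ is obtained from $G_{i-1}$ either by suppressing a vertex of in-degree one and out-degree one, or by deleting an arc of a pair of parallel arcs. Let $u$ and $v$ be vertices of $G_i$ for some $i$. Then: (i) if there is a path from $u$ to $v$ in $G_i$, then there is a path from $u$ to $v$ in $G_A$; (ii) for a (fixed) leaf $\ell$, every path from $u$ to $\ell$ traverses $v$ in $G_A$ if and only if every path from $u$ to $\ell$ traverses $v$ in $G_i$.
   Context: All paths are directed. A (binary) phylogenetic network $\mathcal N$ on a non-empty finite set $X$ is a rooted acyclic directed graph with no parallel arcs such that: the unique root has in-degree 0 and out-degree 2; the set of vertices of out-degree 0 is $X$ (the leaves), each of in-degree 1; every other vertex has either in-degree 1 and out-degree 2 (tree vertex) or in-degree 2 and out-degree 1 (reticulation). If $|X|=1$, $\mathcal N$ may also be the single vertex of $X$. A stable ancestor of $X'\subseteq X$ is a vertex $u$ such that for every $x\in X'$ every path from the root to $x$ traverses $u$; ${\rm lsa}(X')$, the lowest stable ancestor, is the unique stable ancestor of $X'$ with no other stable ancestor of $X'$ as a descendant. The path graph $G_A$ of $\mathcal N$ on $A\subseteq X$ is the subgraph consisting of all vertices and arcs lying on paths from ${\rm lsa}(A)$ to leaves in $A$. The full simplification of a directed graph is obtained by repeatedly suppressing vertices of in-degree one and out-degree one and deleting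 exactly one arc of any pair of parallel arcs until neither applies; $\mathcal N_A$, the network exhibited by $\mathcal N$ on $A$, is the full simplification of $G_A$ (its vertices are vertices of $G_A$). -}

module Defs where

open import Data.Nat using (ℕ; _≟_)
open import Data.Product using (_×_; _,_; proj₁; proj₂; Σ; ∃; ∃-syntax)
open import Data.Sum using (_⊎_)
open import Data.List using (List; []; _∷_; length; filter)
open import Data.List.Membership.Propositional using (_∈_)
open import Data.List.Relation.Unary.Unique.Propositional using (Unique)
open import Data.List.Relation.Binary.Permutation.Propositional using (_↭_)
open import Relation.Binary.PropositionalEquality using (_≡_; _≢_)
open import Relation.Nullary using (¬_)
open import Function.Bundles using (_⇔_)

-- Vertices are natural numbers; an arc is an ordered pair (tail , head).
Arc : Set
Arc = ℕ × ℕ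

-- A finite directed (multi)graph: a vertex list and an arc list.
-- Parallel arcs are repeated entries of the arc list.
record Graph : Set where
  constructor graph
  field
    V : List ℕ
    E : List Arc
open Graph public

indeg : Graph → ℕ → ℕ
indeg G v = length (filter (λ e → proj₂ e ≟ v) (E G))

outdeg : Graph → ℕ → ℕ
outdeg G v = length (filter (λ e → proj₁ e ≟ v) (E G))

data Path (G : Graph) : ℕ → ℕ → Set where
  stop : ∀ {u} → u ∈ V G → Path G u u
  step : ∀ {u w v} → (u , w) ∈ E G → Path G w v → Path G u v

verts : ∀ {G u v} → Path G u v → List ℕ
verts (stop {u} _)   = u ∷ []
verts (step {u} _ p) = u ∷ verts p

arcs : ∀ {G u v} → Path G u v → List Arc
arcs (stop _)            = []
arcs (step {u} {w} _ p)  = (u , w) ∷ arcs p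

WellFormed : Graph → Set
WellFormed G = ∀ {a b} → (a , b) ∈ E G → a ∈ V G × b ∈ V G

Acyclic : Graph → Set
Acyclic G = ∀ {u w} → (u , w) ∈ E G → ¬ Path G w u

record IsProperNet (G : Graph) (X : List ℕ) (ρ : ℕ) : Set where
  field
    uniqV       : Unique (V G)
    uniqE       : Unique (E G)
    wf          : WellFormed G
    acyclic     : Acyclic G
    rootV       : ρ ∈ V G
    rootIn      : indeg G ρ ≡ 0
    rootOut     : outdeg G ρ ≡ 2
    rootNotLeaf : ¬ (ρ ∈ X)
    leavesV     : ∀ {x} → x ∈ X → x ∈ V G
    leafDeg     : ∀ {x} → x ∈ X → indeg G x ≡ 1 × outdeg G x ≡ 0
    others      : ∀ {v} → v ∈ V G → v ≢ ρ → ¬ (v ∈ X) →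
                  (indeg G v ≡ 1 × outdeg G v ≡ 2) ⊎ (indeg G v ≡ 2 × outdeg G v ≡ 1)

-- The degenerate case |X| = 1: the network is the single vertex ρ, X = {ρ}.
IsSingleNet : Graph → List ℕ → ℕ → Set
IsSingleNet G X ρ = V G ≡ ρ ∷ [] × E G ≡ [] × ρ ∈ X × (∀ {y} → y ∈ X → y ≡ ρ)

IsPhyloNet : Graph → List ℕ → ℕ → Set
IsPhyloNet G X ρ = IsProperNet G X ρ ⊎ IsSingleNet G X ρ

StableAncestor : Graph → ℕ → List ℕ → ℕ → Set
StableAncestor N ρ A u =
  u ∈ V N × (∀ {x} → x ∈ A → (p : Path N ρ x) → u ∈ verts p)

IsLSA : Graph → ℕ → List ℕ → ℕ → Set
IsLSA N ρ A u =
  StableAncestor N ρ A u × (∀ w → StableAncestor N ρ A w → Path N u w → w ≡ u)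

-- G is the path graph of N on A, where l = lsa(A): its vertices / arcs are
-- exactly those lying on paths in N from l to leaves in A (each listed once).
IsPathGraph : Graph → ℕ → List ℕ → Graph → Set
IsPathGraph N l A G =
  Unique (V G) × Unique (E G) ×
  (∀ v → v ∈ V G ⇔ (∃[ x ] (x ∈ A × Σ (Path N l x) (λ p → v ∈ verts p)))) ×
  (∀ e → e ∈ E G ⇔ (∃[ x ] (x ∈ A × Σ (Path N l x) (λ p → e ∈ arcs p))))

Suppress : Graph → Graph → Set
Suppress G H = ∃[ w ] ∃[ a ] ∃[ b ] ∃[ R ] ∃[ W ]
  (indeg G w ≡ 1 × outdeg G w ≡ 1 ×
   V G ↭ w ∷ W × V H ↭ W ×
   E G ↭ (a , w) ∷ (w , b) ∷ R × E H ↭ (a , b) ∷ R)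

DeleteParallel : Graph → Graph → Set
DeleteParallel G H = ∃[ a ] ∃[ b ] ∃[ R ]
  (E G ↭ (a , b) ∷ (a , b) ∷ R × E H ↭ (a , b) ∷ R × V H ↭ V G)

Step : Graph → Graph → Set
Step G H = Suppress G H ⊎ DeleteParallel G H

FullySimplified : Graph → Set
FullySimplified G = ∀ H → ¬ Step G H

-- Each simplification step can be undone on paths: an arc (a , b) created by suppressing
-- w re-expands to a → w → b, and a deleted parallel arc has a surviving copy.  Conversely
-- a path of G₀ between vertices that survive to Gᵢ is shortened step by step, passing
-- through no new vertex.  Hence reachability and "every u–ℓ path meets v" agree between
-- G₀ and Gᵢ, the latter because a leaf ℓ is a sink and sinks are never suppressed.
module Submission where

open import Defs
open import Data.Nat using (ℕ; suc; _<_; _≤_; _≟_; zero)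
open import Data.Nat.Properties using (<⇒≤; <⇒≢; suc-injective)
open import Data.Product using (_×_; _,_; proj₁; proj₂; Σ)
open import Data.Sum using (inj₁; inj₂)
open import Data.List using (List; []; _∷_; length; filter)
open import Data.List.Properties using (filter-accept; filter-reject; filter-some)
open import Data.List.Membership.Propositional using (_∈_; _∉_; lose)
open import Data.List.Relation.Unary.Any using (here; there)
import Data.List.Relation.Unary.All as All
open import Data.List.Relation.Unary.AllPairs using (_∷_)
open import Data.List.Relation.Unary.Unique.Propositional using (Unique)
open import Data.List.Relation.Binary.Subset.Propositional using (_⊆_)
open import Data.List.Relation.Binary.Subset.Propositional.Properties
  using (⊆-refl; ⊆-trans; ⊆-reflexive; ⊆-reflexive-↭; xs⊆x∷xs; ∷⁺ʳ)
open import Data.List.Relation.Binary.Permutation.Propositional using (_↭_; ↭-sym; ↭⇒↭ₛ)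
open import Data.List.Relation.Binary.Permutation.Propositional.Properties using (filter-↭; ↭-length)
open import Data.List.Relation.Binary.Permutation.Setoid.Properties using (Unique-resp-↭)
open import Relation.Binary.PropositionalEquality using (_≡_; _≢_; refl; sym; trans; cong; subst; setoid)
open import Data.Empty using (⊥-elim)
open import Relation.Nullary using (¬_)
open import Relation.Unary using (Pred; Decidable)
open import Function.Bundles using (_⇔_; mk⇔; Equivalence)
open import Level using (0ℓ)

private variable
  G H K : Graph
  x y ℓ : ℕ

Unique-resp-↭ℕ : {xs ys : List ℕ} → xs ↭ ys → Unique xs → Unique ys
Unique-resp-↭ℕ xs↭ys = Unique-resp-↭ (setoid ℕ) (↭⇒↭ₛ xs↭ys)

head∉tail : ∀ {z} {zs : List ℕ} → Unique (z ∷ zs) → z ∉ zs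
head∉tail (z∉zs ∷ _) z∈zs = All.lookup z∉zs z∈zs refl

filter-sole : {A : Set} {P : Pred A 0ℓ} (P? : Decidable P) {a : A} {as : List A} →
              length (filter P? (a ∷ as)) ≡ 1 → P a → ∀ {b} → b ∈ as → ¬ P b
filter-sole P? one pa b∈as pb =
  <⇒≢ (filter-some P? (lose b∈as pb)) (sym (suc-injective (trans (cong length (sym (filter-accept P? pa))) one)))

filter-length-↭ : {A : Set} {P : Pred A 0ℓ} (P? : Decidable P) {as bs : List A} →
                  as ↭ bs → length (filter P? as) ≡ length (filter P? bs)
filter-length-↭ P? as↭bs = ↭-length (filter-↭ P? as↭bs)

Sink : Graph → ℕ → Set
Sink G ℓ = ∀ x → (ℓ , x) ∉ E G

Sink-anti : ∀ {G H ℓ} → E H ⊆ E G → Sink G ℓ → Sink H ℓ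
Sink-anti EH⊆EG sink x ℓx∈EH = sink x (EH⊆EG ℓx∈EH)

endpoint∈V : Path G x y → y ∈ V G
endpoint∈V (stop y∈V) = y∈V
endpoint∈V (step _ p) = endpoint∈V p

arcs⊆E : (p : Path G x y) → arcs p ⊆ E G
arcs⊆E (step e∈E p) (here refl) = e∈E
arcs⊆E (step e∈E p) (there e∈p) = arcs⊆E p e∈p

transport : V G ⊆ V H → E G ⊆ E H → Path G x y → Path H x y
transport VG⊆VH EG⊆EH (stop x∈V) = stop (VG⊆VH x∈V)
transport VG⊆VH EG⊆EH (step e∈E p) = step (EG⊆EH e∈E) (transport VG⊆VH EG⊆EH p)

verts-transport : (VG⊆VH : V G ⊆ V H) (EG⊆EH : E G ⊆ E H) (p : Path G x y) →
                  verts (transport VG⊆VH EG⊆EH p) ≡ verts p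
verts-transport VG⊆VH EG⊆EH (stop _) = refl
verts-transport VG⊆VH EG⊆EH (step {x} _ p) = cong (x ∷_) (verts-transport VG⊆VH EG⊆EH p)

Lifts : Graph → Graph → Set
Lifts G H = ∀ {x y} (p : Path H x y) →
            Σ (Path G x y) λ q → ∀ {v} → v ∈ V H → v ∈ verts q → v ∈ verts p

Projects : Graph → Graph → Set
Projects G H = ∀ {x y} → x ∈ V H → y ∈ V H → (p : Path G x y) →
               Σ (Path H x y) λ q → verts q ⊆ verts p

record PathReduction (G H : Graph) : Set where
  field
    V⊆           : V H ⊆ V G
    lifts        : Lifts G H
    projects     : Projects G H
    keeps-sink   : Sink G ℓ → Sink H ℓ
    keeps-sink∈V : Sink G ℓ → ℓ ∈ V G → ℓ ∈ V H

PathReduction-refl : PathReduction G G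
PathReduction-refl = record
  { V⊆           = ⊆-refl
  ; lifts        = λ p → p , λ _ v∈p → v∈p
  ; projects     = λ _ _ p → p , ⊆-refl
  ; keeps-sink   = λ sink → sink
  ; keeps-sink∈V = λ _ ℓ∈V → ℓ∈V
  }

PathReduction-trans : PathReduction G H → PathReduction H K → PathReduction G K
PathReduction-trans {G} {H} {K} GH HK = record
  { V⊆           = ⊆-trans (V⊆ HK) (V⊆ GH)
  ; lifts        = lifts′
  ; projects     = projects′
  ; keeps-sink   = λ sink → keeps-sink HK (keeps-sink GH sink)
  ; keeps-sink∈V = λ sink ℓ∈V → keeps-sink∈V HK (keeps-sink GH sink) (keeps-sink∈V GH sink ℓ∈V)
  }
  where
  open PathReduction

  lifts′ : Lifts G K
  lifts′ p with lifts HK p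
  ... | q , q∼p with lifts GH q
  ... | r , r∼q = r , λ v∈K v∈r → q∼p v∈K (r∼q (V⊆ HK v∈K) v∈r)

  projects′ : Projects G K
  projects′ x∈K y∈K p with projects GH (V⊆ HK x∈K) (V⊆ HK y∈K) p
  ... | q , q⊆p with projects HK x∈K y∈K q
  ... | r , r⊆q = r , ⊆-trans r⊆q q⊆p

-- Distinct vertex names are what guarantee that the suppressed vertex w leaves the graph.
module Suppression (uniqueG : Unique (V G)) {w a b : ℕ} {R : List Arc} {W : List ℕ}
  (in-w : indeg G w ≡ 1) (out-w : outdeg G w ≡ 1) (VG↭ : V G ↭ w ∷ W) (VH↭ : V H ↭ W)
  (EG↭ : E G ↭ (a , w) ∷ (w , b) ∷ R) (EH↭ : E H ↭ (a , b) ∷ R) where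

  private
    tail≟w : Decidable λ (e : Arc) → proj₁ e ≡ w
    tail≟w e = proj₁ e ≟ w
    head≟w : Decidable λ (e : Arc) → proj₂ e ≡ w
    head≟w e = proj₂ e ≟ w
    out-w′ : length (filter tail≟w ((a , w) ∷ (w , b) ∷ R)) ≡ 1
    out-w′ = trans (sym (filter-length-↭ tail≟w EG↭)) out-w
    in-w′ : length (filter head≟w ((a , w) ∷ (w , b) ∷ R)) ≡ 1
    in-w′  = trans (sym (filter-length-↭ head≟w EG↭)) in-w

  a≢w : a ≢ w
  a≢w a≡w = filter-sole tail≟w out-w′ a≡w (here refl) refl

  b≢w : b ≢ w
  b≢w = filter-sole head≟w in-w′ refl (here refl)

  no-arc-from-w : (w , x) ∉ R
  no-arc-from-w w,x∈R =
    filter-sole tail≟w (trans (cong length (sym (filter-reject tail≟w a≢w))) out-w′) refl w,x∈R refl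

  no-arc-into-w : (x , w) ∉ R
  no-arc-into-w x,w∈R = filter-sole head≟w in-w′ refl (there x,w∈R) refl

  w∉VH : w ∉ V H
  w∉VH w∈VH = head∉tail (Unique-resp-↭ℕ VG↭ uniqueG) (⊆-reflexive-↭ VH↭ w∈VH)

  VH⊆VG : V H ⊆ V G
  VH⊆VG v∈VH = ⊆-reflexive-↭ (↭-sym VG↭) (there (⊆-reflexive-↭ VH↭ v∈VH))

  VG⊆VH : ∀ {v} → v ∈ V G → v ≢ w → v ∈ V H
  VG⊆VH v∈VG v≢w with ⊆-reflexive-↭ VG↭ v∈VG
  ... | here v≡w  = ⊥-elim (v≢w v≡w)
  ... | there v∈W = ⊆-reflexive-↭ (↭-sym VH↭) v∈W

  unique : Unique (V H)
  unique with Unique-resp-↭ℕ VG↭ uniqueG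
  ... | _ ∷ uniqueW = Unique-resp-↭ℕ (↭-sym VH↭) uniqueW

  arcG : (a , w) ∷ (w , b) ∷ R ⊆ E G
  arcG = ⊆-reflexive-↭ (↭-sym EG↭)

  arcH : (a , b) ∷ R ⊆ E H
  arcH = ⊆-reflexive-↭ (↭-sym EH↭)

  lifts : Lifts G H
  lifts (stop x∈VH) = stop (VH⊆VG x∈VH) , λ _ v∈p → v∈p
  lifts (step e∈EH p) with ⊆-reflexive-↭ EH↭ e∈EH | lifts p
  ... | here refl | q , q∼p =
        step (arcG (here refl)) (step (arcG (there (here refl))) q) ,
        λ { _ (here refl) → here refl
          ; v∈VH (there (here refl)) → ⊥-elim (w∉VH v∈VH)
          ; v∈VH (there (there v∈q)) → there (q∼p v∈VH v∈q) }
  ... | there e∈R | q , q∼p =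
        step (arcG (there (there e∈R))) q ,
        λ { _ (here refl) → here refl ; v∈VH (there v∈q) → there (q∼p v∈VH v∈q) }

  project : x ≢ w → y ∈ V H → (p : Path G x y) → Σ (Path H x y) λ q → verts q ⊆ verts p
  project-from-w : y ∈ V H → (p : Path G w y) → Σ (Path H a y) λ q → verts q ⊆ a ∷ verts p

  project _ y∈VH (stop _) = stop y∈VH , ⊆-refl
  project x≢w y∈VH (step e∈EG p) with ⊆-reflexive-↭ EG↭ e∈EG
  ... | here refl         = project-from-w y∈VH p
  ... | there (here refl) = ⊥-elim (x≢w refl)
  ... | there (there e∈R) with project (λ { refl → no-arc-into-w e∈R }) y∈VH p
  ...   | q , q⊆p = step (arcH (there e∈R)) q , ∷⁺ʳ _ q⊆p

  project-from-w y∈VH (stop _) = ⊥-elim (w∉VH y∈VH)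
  project-from-w y∈VH (step e∈EG p) with ⊆-reflexive-↭ EG↭ e∈EG
  ... | here e≡aw         = ⊥-elim (a≢w (sym (cong proj₁ e≡aw)))
  ... | there (there e∈R) = ⊥-elim (no-arc-from-w e∈R)
  ... | there (here refl) with project b≢w y∈VH p
  ...   | q , q⊆p = step (arcH (here refl)) q , ∷⁺ʳ a (⊆-trans q⊆p (xs⊆x∷xs _ w))

  keeps-sink : Sink G ℓ → Sink H ℓ
  keeps-sink sink x ℓx∈EH with ⊆-reflexive-↭ EH↭ ℓx∈EH
  ... | here refl  = sink w (arcG (here refl))
  ... | there ℓx∈R = sink x (arcG (there (there ℓx∈R)))

  reduction : PathReduction G H
  reduction = record
    { V⊆           = VH⊆VG
    ; lifts        = lifts
    ; projects     = λ x∈VH → project (λ { refl → w∉VH x∈VH })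
    ; keeps-sink   = keeps-sink
    ; keeps-sink∈V = λ sink ℓ∈VG → VG⊆VH ℓ∈VG λ { refl → sink b (arcG (there (here refl))) }
    }

module ParallelDeletion {G H : Graph} {a b : ℕ} {R : List Arc}
  (EG↭ : E G ↭ (a , b) ∷ (a , b) ∷ R) (EH↭ : E H ↭ (a , b) ∷ R) (VH↭ : V H ↭ V G) where

  EG⊆EH : E G ⊆ E H
  EG⊆EH e∈EG with ⊆-reflexive-↭ EG↭ e∈EG
  ... | here e≡ab    = ⊆-reflexive-↭ (↭-sym EH↭) (here e≡ab)
  ... | there e∈ab∷R = ⊆-reflexive-↭ (↭-sym EH↭) e∈ab∷R

  EH⊆EG : E H ⊆ E G
  EH⊆EG = ⊆-trans (⊆-reflexive-↭ EH↭) (⊆-trans (xs⊆x∷xs _ (a , b)) (⊆-reflexive-↭ (↭-sym EG↭)))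

  VH⊆VG : V H ⊆ V G
  VH⊆VG = ⊆-reflexive-↭ VH↭

  VG⊆VH : V G ⊆ V H
  VG⊆VH = ⊆-reflexive-↭ (↭-sym VH↭)

  reduction : PathReduction G H
  reduction = record
    { V⊆           = VH⊆VG
    ; lifts        = λ p → transport VH⊆VG EH⊆EG p , λ _ → ⊆-reflexive (verts-transport VH⊆VG EH⊆EG p)
    ; projects     = λ _ _ p → transport VG⊆VH EG⊆EH p , ⊆-reflexive (verts-transport VG⊆VH EG⊆EH p)
    ; keeps-sink   = Sink-anti {G = G} {H = H} EH⊆EG
    ; keeps-sink∈V = λ _ → VG⊆VH
    }

Step-unique : Unique (V G) → Step G H → Unique (V H)
Step-unique uniqueG (inj₁ (_ , _ , _ , _ , _ , in-w , out-w , VG↭ , VH↭ , EG↭ , EH↭)) =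
  Suppression.unique uniqueG in-w out-w VG↭ VH↭ EG↭ EH↭
Step-unique uniqueG (inj₂ (_ , _ , _ , _ , _ , VH↭)) = Unique-resp-↭ℕ (↭-sym VH↭) uniqueG

Step-reduction : Unique (V G) → Step G H → PathReduction G H
Step-reduction uniqueG (inj₁ (_ , _ , _ , _ , _ , in-w , out-w , VG↭ , VH↭ , EG↭ , EH↭)) =
  Suppression.reduction uniqueG in-w out-w VG↭ VH↭ EG↭ EH↭
Step-reduction _ (inj₂ (_ , _ , _ , EG↭ , EH↭ , VH↭)) = ParallelDeletion.reduction EG↭ EH↭ VH↭

Steps-reduction : (k : ℕ) (G : ℕ → Graph) → (∀ i → i < k → Step (G i) (G (suc i))) →
                  Unique (V (G 0)) → ∀ i → i ≤ k → Unique (V (G i)) × PathReduction (G 0) (G i)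
Steps-reduction k G steps unique₀ zero _ = unique₀ , PathReduction-refl
Steps-reduction k G steps unique₀ (suc i) i<k with Steps-reduction k G steps unique₀ i (<⇒≤ i<k)
... | uniqueᵢ , reductionᵢ =
  Step-unique uniqueᵢ (steps i i<k) , PathReduction-trans reductionᵢ (Step-reduction uniqueᵢ (steps i i<k))

leaf-sink : ∀ {N X ρ} → IsPhyloNet N X ρ → ℓ ∈ X → Sink N ℓ
leaf-sink (inj₁ net) ℓ∈X _ ℓx∈E =
  <⇒≢ (filter-some (λ e → proj₁ e ≟ _) (lose ℓx∈E refl)) (sym (proj₂ (IsProperNet.leafDeg net ℓ∈X)))
leaf-sink (inj₂ (_ , E≡[] , _)) _ _ ℓx∈E with subst (_ ∈_) E≡[] ℓx∈E
... | ()

pathGraph-E⊆ : ∀ {N l A} → IsPathGraph N l A G → E G ⊆ E N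
pathGraph-E⊆ (_ , _ , _ , E⇔) e∈EG with Equivalence.to (E⇔ _) e∈EG
... | _ , _ , p , e∈p = arcs⊆E p e∈p

lemma2p1 : (N : Graph) (X : List ℕ) (ρ : ℕ) → IsPhyloNet N X ρ →
           (A : List ℕ) → A ≢ [] → (∀ {x} → x ∈ A → x ∈ X) →
           (l : ℕ) → IsLSA N ρ A l →
           (k : ℕ) (G : ℕ → Graph) → IsPathGraph N l A (G 0) →
           (∀ i → i < k → Step (G i) (G (suc i))) → FullySimplified (G k) →
           ∀ i → i ≤ k → ∀ u v → u ∈ V (G i) → v ∈ V (G i) →
           (Path (G i) u v → Path (G 0) u v) ×
           (∀ ℓ → ℓ ∈ X →
             ((∀ (p : Path (G 0) u ℓ) → v ∈ verts p) ⇔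
              (∀ (p : Path (G i) u ℓ) → v ∈ verts p)))
lemma2p1 N X ρ net A _ _ l _ k G pathGraph steps _ i i≤k u v u∈Gᵢ v∈Gᵢ =
  (λ p → proj₁ (lifts p)) , λ ℓ ℓ∈X → mk⇔ meets-in-Gᵢ (meets-in-G₀ ℓ∈X)
  where
  open PathReduction (proj₂ (Steps-reduction k G steps (proj₁ pathGraph) i i≤k))

  meets-in-Gᵢ : ∀ {ℓ} → (∀ (p : Path (G 0) u ℓ) → v ∈ verts p) → ∀ (p : Path (G i) u ℓ) → v ∈ verts p
  meets-in-Gᵢ meets p = let q , q∼p = lifts p in q∼p v∈Gᵢ (meets q)

  meets-in-G₀ : ∀ {ℓ} → ℓ ∈ X → (∀ (p : Path (G i) u ℓ) → v ∈ verts p) → ∀ (p : Path (G 0) u ℓ) → v ∈ verts p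
  meets-in-G₀ ℓ∈X meets p =
    let sink₀ = Sink-anti {G = N} {H = G 0} (pathGraph-E⊆ pathGraph) (leaf-sink net ℓ∈X)
        q , q⊆p = projects u∈Gᵢ (keeps-sink∈V sink₀ (endpoint∈V p)) p
    in q⊆p (meets q)
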